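{- Let $f(t)$ be a gamma positive polynomial with center of symmetry $n/2$ and with $\mathsf{len}(f)$ odd. Then $f(t)=p_1(t)+p_2(t)$ where $p_1(t)$ and $p_2(t)$ are gamma positive polynomials with centers of symmetry $(n-1)/2$ and $(n+1)/2$ respectively. Further, both $p_1(t)$ and $p_2(t)$ have even length.
   Context: For a nonzero polynomial $f(t)=\sum_{i=r}^{N}a_it^i$ with $a_r\neq0\neq a_N$: $\mathsf{len}(f)=N-r$; $f$ is palindromic if $a_{r+i}=a_{N-i}$ for $0\le i\le\lfloor (N-r)/2\rfloor$; its center of symmetry is $(N+r)/2$; and $f$ is gamma positive if it is palindromic and $f(t)=\sum_{i=0}^{\lfloor (N-r)/2\rfloor}\gamma_i t^{r+i}(1+t)^{N-r-2i}$ with all $\gamma_i\geq 0$.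
   Formalization: The polynomials $f(t)$, $p_1(t)$ and $p_2(t)$ have rational coefficients, and the numbers $\gamma_i$ in each gamma expansion are rational. -}

module Defs where

open import Data.Nat as ℕ using (ℕ; zero; suc; _∸_; _/_; _%_)
open import Data.Rational as ℚ using (ℚ; 0ℚ; 1ℚ)
open import Data.Product using (Σ; _×_; ∃)
open import Relation.Binary.PropositionalEquality using (_≡_; _≢_)

-- A polynomial with rational coefficients, represented by its coefficient
-- sequence: (f j) is the coefficient of t^j.  Nonzero-ness and finiteness of
-- support are expressed by the 'Support' record below.
Poly : Set
Poly = ℕ → ℚ

_≈ₚ_ : Poly → Poly → Set
f ≈ₚ g = ∀ j → f j ≡ g j

zeroₚ : Poly
zeroₚ _ = 0ℚ

oneₚ : Poly
oneₚ zero    = 1ℚ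
oneₚ (suc _) = 0ℚ

_⊕_ : Poly → Poly → Poly
(f ⊕ g) j = f j ℚ.+ g j

scale : ℚ → Poly → Poly
scale c f j = c ℚ.* f j

shift : Poly → Poly
shift f zero    = 0ℚ
shift f (suc j) = f j

tpow : ℕ → Poly → Poly
tpow zero    f = f
tpow (suc k) f = shift (tpow k f)

onePlusT^ : ℕ → Poly
onePlusT^ zero    = oneₚ
onePlusT^ (suc m) = onePlusT^ m ⊕ shift (onePlusT^ m)

sumₚ : ℕ → (ℕ → Poly) → Poly
sumₚ zero    F = F 0
sumₚ (suc d) F = sumₚ d F ⊕ F (suc d)

record Support (f : Poly) (r N : ℕ) : Set where
  field
    r≤N     : r ℕ.≤ N
    low≢0   : f r ≢ 0ℚ
    high≢0  : f N ≢ 0ℚ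
    below   : ∀ i → i ℕ.< r → f i ≡ 0ℚ
    above   : ∀ i → N ℕ.< i → f i ≡ 0ℚ

Palindromic : Poly → ℕ → ℕ → Set
Palindromic f r N = ∀ i → i ℕ.≤ (N ∸ r) / 2 → f (r ℕ.+ i) ≡ f (N ∸ i)

GammaPositiveRN : Poly → ℕ → ℕ → Set
GammaPositiveRN f r N =
  Support f r N × Palindromic f r N ×
  Σ (ℕ → ℚ) λ γ →
    (∀ i → i ℕ.≤ (N ∸ r) / 2 → 0ℚ ℚ.≤ γ i) ×
    (f ≈ₚ sumₚ ((N ∸ r) / 2)
             (λ i → scale (γ i) (tpow (r ℕ.+ i) (onePlusT^ (N ∸ r ∸ 2 ℕ.* i)))))

-- f is gamma positive with center of symmetry c2/2 (i.e. (N+r)/2 = c2/2)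
-- and length ℓ (= N - r)
GammaPositiveWith : Poly → (c2 ℓ : ℕ) → Set
GammaPositiveWith f c2 ℓ =
  Σ ℕ λ r → Σ ℕ λ N → GammaPositiveRN f r N × N ℕ.+ r ≡ c2 × N ∸ r ≡ ℓ

-- Write f = Σᵢ γᵢ t^(r+i) (1+t)^(2d+1-2i).  Every exponent of (1+t) is odd, so
-- f = (1+t)·p = p + t·p with p = Σᵢ γᵢ t^(r+i) (1+t)^(2d-2i), and p₁ = p,
-- p₂ = t·p are gamma positive with the same γ and length 2d.  That p is
-- palindromic and has the right lowest and highest coefficients is read off
-- f = p + t·p by peeling coefficients from both ends.
module Submission where

open import Defs
open import Data.Nat using (ℕ; suc; _%_; _∸_)
open import Data.Product using (Σ; _×_)
open import Relation.Binary.PropositionalEquality using (_≡_)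

open import Algebra.Bundles using (CommutativeMonoid)
open import Data.Nat using (zero; _≤_; _<_; _+_; _*_; _/_; _≤?_; z≤n; s≤s; s≤s⁻¹)
open import Data.Nat.Properties
  using ( ≤-refl; ≤-trans; ≤-reflexive; <-≤-trans; ≤-<-trans; ≰⇒>; ≮⇒≥; m≤n⇒m≤1+n
        ; +-comm; +-assoc; +-suc; +-identityʳ; m≤m+n; +-monoʳ-≤; +-monoˡ-≤; +-cancelˡ-≤
        ; m+n∸m≡n; m+[n∸m]≡n; +-∸-assoc; *-comm; *-monoʳ-≤; module ≤-Reasoning)
open import Data.Nat.Divisibility using (divides-refl)
open import Data.Nat.DivMod using (m≡m%n+[m/n]*n; m%n<n; m*n/n≡m; m*n%n≡0; m/n≤m; m/n*n≤m; +-distrib-/-∣ʳ)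
open import Data.Rational as Q using (ℚ; 0ℚ)
import Data.Rational.Properties as QP
open import Algebra.Properties.CommutativeSemigroup
  (CommutativeMonoid.commutativeSemigroup QP.+-0-commutativeMonoid) using (interchange)
open import Algebra.Properties.Group QP.+-0-group using (∙-cancelʳ)
open import Data.Product using (_,_; proj₁; proj₂)
open import Data.Sum using (_⊎_; inj₁; inj₂; [_,_]′)
open import Relation.Nullary using (yes; no)
open import Relation.Binary.PropositionalEquality
  using (_≢_; refl; sym; trans; cong; cong₂; subst; module ≡-Reasoning)

private
  variable
    f g h : Poly
    r N L : ℕ

[n*2]/2≡n : ∀ n → n * 2 / 2 ≡ n
[n*2]/2≡n n = m*n/n≡m n 2

[1+n*2]/2≡n : ∀ n → suc (n * 2) / 2 ≡ n
[1+n*2]/2≡n n = trans (+-distrib-/-∣ʳ 1 {d = 2} (divides-refl n)) ([n*2]/2≡n n)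

2*[n/2]≤n : ∀ n → 2 * (n / 2) ≤ n
2*[n/2]≤n n = subst (_≤ n) (*-comm (n / 2) 2) (m/n*n≤m n 2)

n≤1+2*[n/2] : ∀ n → n ≤ suc (2 * (n / 2))
n≤1+2*[n/2] n = begin
  n                       ≡⟨ m≡m%n+[m/n]*n n 2 ⟩
  n % 2 + n / 2 * 2       ≤⟨ +-monoˡ-≤ (n / 2 * 2) (s≤s⁻¹ (m%n<n n 2)) ⟩
  suc (n / 2 * 2)         ≡⟨ cong suc (*-comm (n / 2) 2) ⟩
  suc (2 * (n / 2))       ∎
  where open ≤-Reasoning

≤half⊎≤half : ∀ {i j n} → i + j ≡ n → i ≤ n / 2 ⊎ j ≤ n / 2
≤half⊎≤half {i} {j} {n} i+j≡n with i ≤? n / 2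
... | yes i≤ = inj₁ i≤
... | no i≰ =
  inj₂ (subst (j ≤_) (+-identityʳ (n / 2)) (+-cancelˡ-≤ (suc (n / 2)) j (n / 2 + 0) bound))
  where
  bound : suc (n / 2) + j ≤ suc (n / 2 + (n / 2 + 0))
  bound = ≤-trans (+-monoˡ-≤ j (≰⇒> i≰)) (≤-trans (≤-reflexive i+j≡n) (n≤1+2*[n/2] n))

-- (1 + t)·g, so that onePlusT^ (suc m) is definitionally mulOnePlusT (onePlusT^ m)
mulOnePlusT : Poly → Poly
mulOnePlusT g = g ⊕ shift g

shift-cong : g ≈ₚ h → shift g ≈ₚ shift h
shift-cong g≈h zero    = refl
shift-cong g≈h (suc j) = g≈h j

scale-shift : ∀ c g → scale c (shift g) ≈ₚ shift (scale c g)
scale-shift c g zero    = QP.*-zeroʳ c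
scale-shift c g (suc j) = refl

mulOnePlusT-cong : g ≈ₚ h → mulOnePlusT g ≈ₚ mulOnePlusT h
mulOnePlusT-cong g≈h j = cong₂ Q._+_ (g≈h j) (shift-cong g≈h j)

shift-mulOnePlusT : ∀ g → shift (mulOnePlusT g) ≈ₚ mulOnePlusT (shift g)
shift-mulOnePlusT g zero    = sym (QP.+-identityˡ 0ℚ)
shift-mulOnePlusT g (suc j) = refl

tpow-mulOnePlusT : ∀ k g → tpow k (mulOnePlusT g) ≈ₚ mulOnePlusT (tpow k g)
tpow-mulOnePlusT zero    g j = refl
tpow-mulOnePlusT (suc k) g j =
  trans (shift-cong (tpow-mulOnePlusT k g) j) (shift-mulOnePlusT (tpow k g) j)

scale-mulOnePlusT : ∀ c g → scale c (mulOnePlusT g) ≈ₚ mulOnePlusT (scale c g)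
scale-mulOnePlusT c g j =
  trans (QP.*-distribˡ-+ c (g j) (shift g j)) (cong (c Q.* g j Q.+_) (scale-shift c g j))

sumₚ-cong : ∀ d {F G : ℕ → Poly} → (∀ i → i ≤ d → F i ≈ₚ G i) → sumₚ d F ≈ₚ sumₚ d G
sumₚ-cong zero    F≈G j = F≈G 0 z≤n j
sumₚ-cong (suc d) F≈G j =
  cong₂ Q._+_ (sumₚ-cong d (λ i i≤d → F≈G i (m≤n⇒m≤1+n i≤d)) j) (F≈G (suc d) ≤-refl j)

sumₚ-⊕ : ∀ d F G → sumₚ d (λ i → F i ⊕ G i) ≈ₚ (sumₚ d F ⊕ sumₚ d G)
sumₚ-⊕ zero    F G j = refl
sumₚ-⊕ (suc d) F G j =
  trans (cong (Q._+ (F (suc d) j Q.+ G (suc d) j)) (sumₚ-⊕ d F G j))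
        (interchange (sumₚ d F j) (sumₚ d G j) (F (suc d) j) (G (suc d) j))

sumₚ-shift : ∀ d F → sumₚ d (λ i → shift (F i)) ≈ₚ shift (sumₚ d F)
sumₚ-shift zero    F j       = refl
sumₚ-shift (suc d) F zero    = trans (cong (Q._+ 0ℚ) (sumₚ-shift d F zero)) (QP.+-identityˡ 0ℚ)
sumₚ-shift (suc d) F (suc j) = cong (Q._+ F (suc d) j) (sumₚ-shift d F (suc j))

sumₚ-mulOnePlusT : ∀ d F → sumₚ d (λ i → mulOnePlusT (F i)) ≈ₚ mulOnePlusT (sumₚ d F)
sumₚ-mulOnePlusT d F j =
  trans (sumₚ-⊕ d F (λ i → shift (F i)) j) (cong (sumₚ d F j Q.+_) (sumₚ-shift d F j))

sumₚ-vanishes : ∀ d F j → (∀ i → i ≤ d → F i j ≡ 0ℚ) → sumₚ d F j ≡ 0ℚ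
sumₚ-vanishes zero    F j F≡0 = F≡0 0 z≤n
sumₚ-vanishes (suc d) F j F≡0 =
  trans (cong₂ Q._+_ (sumₚ-vanishes d F j (λ i i≤d → F≡0 i (m≤n⇒m≤1+n i≤d))) (F≡0 (suc d) ≤-refl))
        (QP.+-identityˡ 0ℚ)

tpow-below : ∀ k g j → j < k → tpow k g j ≡ 0ℚ
tpow-below (suc k) g zero    _         = refl
tpow-below (suc k) g (suc j) (s≤s j<k) = tpow-below k g j j<k

tpow-above : ∀ k m g → (∀ j → m < j → g j ≡ 0ℚ) → ∀ j → k + m < j → tpow k g j ≡ 0ℚ
tpow-above zero    m g g≡0 j       m<j       = g≡0 j m<j
tpow-above (suc k) m g g≡0 (suc j) (s≤s k+m<j) = tpow-above k m g g≡0 j k+m<j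

onePlusT^-above : ∀ m j → m < j → onePlusT^ m j ≡ 0ℚ
onePlusT^-above zero    (suc j) _         = refl
onePlusT^-above (suc m) (suc j) (s≤s m<j) =
  trans (cong₂ Q._+_ (onePlusT^-above m (suc j) (m≤n⇒m≤1+n m<j)) (onePlusT^-above m j m<j))
        (QP.+-identityˡ 0ℚ)

gammaTerm : (ℕ → ℚ) → ℕ → ℕ → ℕ → Poly
gammaTerm γ r L i = scale (γ i) (tpow (r + i) (onePlusT^ (L ∸ 2 * i)))

gammaSum : (ℕ → ℚ) → ℕ → ℕ → Poly
gammaSum γ r L = sumₚ (L / 2) (gammaTerm γ r L)

gammaTerm-suc : ∀ γ r L i → 2 * i ≤ L → gammaTerm γ r (suc L) i ≈ₚ mulOnePlusT (gammaTerm γ r L i)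
gammaTerm-suc γ r L i 2i≤L j = begin
  γ i Q.* tpow (r + i) (onePlusT^ (suc L ∸ 2 * i)) j
    ≡⟨ cong (λ m → γ i Q.* tpow (r + i) (onePlusT^ m) j) (+-∸-assoc 1 2i≤L) ⟩
  γ i Q.* tpow (r + i) (mulOnePlusT (onePlusT^ (L ∸ 2 * i))) j
    ≡⟨ cong (γ i Q.*_) (tpow-mulOnePlusT (r + i) (onePlusT^ (L ∸ 2 * i)) j) ⟩
  scale (γ i) (mulOnePlusT (tpow (r + i) (onePlusT^ (L ∸ 2 * i)))) j
    ≡⟨ scale-mulOnePlusT (γ i) (tpow (r + i) (onePlusT^ (L ∸ 2 * i))) j ⟩
  mulOnePlusT (gammaTerm γ r L i) j ∎
  where open ≡-Reasoning

gammaTerm-below : ∀ γ r L i j → j < r → gammaTerm γ r L i j ≡ 0ℚ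
gammaTerm-below γ r L i j j<r =
  trans (cong (γ i Q.*_) (tpow-below (r + i) _ j (<-≤-trans j<r (m≤m+n r i)))) (QP.*-zeroʳ (γ i))

gammaTerm-above : ∀ γ r L i j → 2 * i ≤ L → r + L < j → gammaTerm γ r L i j ≡ 0ℚ
gammaTerm-above γ r L i j 2i≤L r+L<j =
  trans (cong (γ i Q.*_) (tpow-above (r + i) (L ∸ 2 * i) _ (onePlusT^-above (L ∸ 2 * i)) j
                           (≤-<-trans degree≤r+L r+L<j)))
        (QP.*-zeroʳ (γ i))
  where
  degree≤r+L : r + i + (L ∸ 2 * i) ≤ r + L
  degree≤r+L = begin
    r + i + (L ∸ 2 * i)       ≡⟨ +-assoc r i (L ∸ 2 * i) ⟩
    r + (i + (L ∸ 2 * i))     ≤⟨ +-monoʳ-≤ r (+-monoˡ-≤ (L ∸ 2 * i) (m≤m+n i (i + 0))) ⟩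
    r + (2 * i + (L ∸ 2 * i)) ≡⟨ cong (r +_) (m+[n∸m]≡n 2i≤L) ⟩
    r + L                     ∎
    where open ≤-Reasoning

gammaSum-below : ∀ γ r L j → j < r → gammaSum γ r L j ≡ 0ℚ
gammaSum-below γ r L j j<r =
  sumₚ-vanishes (L / 2) (gammaTerm γ r L) j (λ i _ → gammaTerm-below γ r L i j j<r)

gammaSum-above : ∀ γ r L j → r + L < j → gammaSum γ r L j ≡ 0ℚ
gammaSum-above γ r L j r+L<j = sumₚ-vanishes (L / 2) (gammaTerm γ r L) j
  (λ i i≤ → gammaTerm-above γ r L i j (≤-trans (*-monoʳ-≤ 2 i≤) (2*[n/2]≤n L)) r+L<j)

gammaSum-shift : ∀ γ r L → gammaSum γ (suc r) L ≈ₚ shift (gammaSum γ r L)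
gammaSum-shift γ r L j =
  trans (sumₚ-cong (L / 2) (λ i _ → scale-shift (γ i) (tpow (r + i) (onePlusT^ (L ∸ 2 * i)))) j)
        (sumₚ-shift (L / 2) (gammaTerm γ r L) j)

-- all exponents of (1 + t) in an expansion of odd length are odd
gammaSum-odd : ∀ γ r d → gammaSum γ r (suc (d * 2)) ≈ₚ mulOnePlusT (gammaSum γ r (d * 2))
gammaSum-odd γ r d j = begin
  sumₚ (suc (d * 2) / 2) (gammaTerm γ r (suc (d * 2))) j
    ≡⟨ cong (λ k → sumₚ k (gammaTerm γ r (suc (d * 2))) j) ([1+n*2]/2≡n d) ⟩
  sumₚ d (gammaTerm γ r (suc (d * 2))) j
    ≡⟨ sumₚ-cong d (λ i i≤d → gammaTerm-suc γ r (d * 2) i (2i≤d*2 i≤d)) j ⟩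
  sumₚ d (λ i → mulOnePlusT (gammaTerm γ r (d * 2) i)) j
    ≡⟨ sumₚ-mulOnePlusT d (gammaTerm γ r (d * 2)) j ⟩
  mulOnePlusT (sumₚ d (gammaTerm γ r (d * 2))) j
    ≡⟨ mulOnePlusT-cong (λ k → cong (λ m → sumₚ m (gammaTerm γ r (d * 2)) k) (sym ([n*2]/2≡n d))) j ⟩
  mulOnePlusT (gammaSum γ r (d * 2)) j ∎
  where
  open ≡-Reasoning
  2i≤d*2 : ∀ {i} → i ≤ d → 2 * i ≤ d * 2
  2i≤d*2 {i} i≤d = ≤-trans (*-monoʳ-≤ 2 i≤d) (≤-reflexive (*-comm 2 d))

-- Palindromicity over the whole coefficient range, phrased without truncated subtraction.
CoeffSymmetric : Poly → ℕ → ℕ → Set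
CoeffSymmetric f r L = ∀ i j → i + j ≡ L → f (r + i) ≡ f (r + j)

r+L∸i≡r+j : ∀ {i j} r L → i + j ≡ L → r + L ∸ i ≡ r + j
r+L∸i≡r+j {i} {j} r L i+j≡L = begin
  r + L ∸ i       ≡⟨ +-∸-assoc r (subst (i ≤_) i+j≡L (m≤m+n i j)) ⟩
  r + (L ∸ i)     ≡⟨ cong (λ n → r + (n ∸ i)) (sym i+j≡L) ⟩
  r + (i + j ∸ i) ≡⟨ cong (r +_) (m+n∸m≡n i j) ⟩
  r + j           ∎
  where open ≡-Reasoning

palindromic⇒coeffSymmetric : Palindromic f r (r + L) → CoeffSymmetric f r L
palindromic⇒coeffSymmetric {f} {r} {L} pal i j i+j≡L =
  [ (λ i≤ → mirror i≤ i+j≡L) , (λ j≤ → sym (mirror j≤ (trans (+-comm j i) i+j≡L))) ]′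
    (≤half⊎≤half i+j≡L)
  where
  mirror : ∀ {i j} → i ≤ L / 2 → i + j ≡ L → f (r + i) ≡ f (r + j)
  mirror {i} i≤ i+j≡L =
    trans (pal i (subst (i ≤_) (cong (_/ 2) (sym (m+n∸m≡n r L))) i≤)) (cong f (r+L∸i≡r+j r L i+j≡L))

coeffSymmetric⇒palindromic : CoeffSymmetric f r L → Palindromic f r (r + L)
coeffSymmetric⇒palindromic {f} {r} {L} sym-f i i≤ =
  trans (sym-f i (L ∸ i) (m+[n∸m]≡n i≤L)) (cong f (sym (r+L∸i≡r+j r L (m+[n∸m]≡n i≤L))))
  where
  i≤L : i ≤ L
  i≤L = ≤-trans (subst (i ≤_) (cong (_/ 2) (m+n∸m≡n r L)) i≤) (m/n≤m L 2)

lowest-mulOnePlusT : f ≈ₚ mulOnePlusT g → (∀ i → i < r → g i ≡ 0ℚ) → f r ≡ g r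
lowest-mulOnePlusT {f} {g} {zero}  f≈ _    = trans (f≈ 0) (QP.+-identityʳ (g 0))
lowest-mulOnePlusT {f} {g} {suc r} f≈ g≡0 =
  trans (f≈ (suc r)) (trans (cong (g (suc r) Q.+_) (g≡0 r ≤-refl)) (QP.+-identityʳ (g (suc r))))

highest-mulOnePlusT : f ≈ₚ mulOnePlusT g → (∀ i → N < i → g i ≡ 0ℚ) → f (suc N) ≡ g N
highest-mulOnePlusT {f} {g} {N} f≈ g≡0 =
  trans (f≈ (suc N)) (trans (cong (Q._+ g N) (g≡0 (suc N) ≤-refl)) (QP.+-identityˡ (g N)))

support-mulOnePlusT⁻¹ : f ≈ₚ mulOnePlusT g → Support f r (suc N) →
  (∀ i → i < r → g i ≡ 0ℚ) → (∀ i → N < i → g i ≡ 0ℚ) → Support g r N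
support-mulOnePlusT⁻¹ {f} {g} {r} {N} f≈ sup-f below above = record
  { r≤N    = ≮⇒≥ (λ N<r → low≢0 (above r N<r))
  ; low≢0  = low≢0
  ; high≢0 = λ gN≡0 → Support.high≢0 sup-f (trans (highest-mulOnePlusT f≈ above) gN≡0)
  ; below  = below
  ; above  = above
  }
  where
  low≢0 : g r ≢ 0ℚ
  low≢0 gr≡0 = Support.low≢0 sup-f (trans (lowest-mulOnePlusT f≈ below) gr≡0)

-- Induction from the outside in: f (r+i+1) = g (r+i+1) + g (r+i) and the mirrored
-- identity for f agree, and g (r+i) already equals its mirror image.
coeffSymmetric-mulOnePlusT⁻¹ : f ≈ₚ mulOnePlusT g → Support g r (r + L) →
  CoeffSymmetric f r (suc L) → CoeffSymmetric g r L
coeffSymmetric-mulOnePlusT⁻¹ {f} {g} {r} {L} f≈ sup-g sym-f = mirror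
  where
  open Support sup-g
  f-at : ∀ k → f (r + suc k) ≡ g (r + suc k) Q.+ g (r + k)
  f-at k = trans (cong f (+-suc r k))
    (trans (f≈ (suc (r + k))) (cong (λ m → g m Q.+ g (r + k)) (sym (+-suc r k))))
  mirror : CoeffSymmetric g r L
  mirror zero j refl = begin
    g (r + 0)       ≡⟨ cong g (+-identityʳ r) ⟩
    g r             ≡⟨ sym (lowest-mulOnePlusT f≈ below) ⟩
    f r             ≡⟨ cong f (sym (+-identityʳ r)) ⟩
    f (r + 0)       ≡⟨ sym-f 0 (suc j) refl ⟩
    f (r + suc j)   ≡⟨ cong f (+-suc r j) ⟩
    f (suc (r + j)) ≡⟨ highest-mulOnePlusT f≈ above ⟩
    g (r + j)       ∎
    where open ≡-Reasoning
  mirror (suc i) j i+j≡L = ∙-cancelʳ (g (r + i)) (g (r + suc i)) (g (r + j)) (begin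
    g (r + suc i) Q.+ g (r + i)     ≡⟨ sym (f-at i) ⟩
    f (r + suc i)                   ≡⟨ sym-f (suc i) (suc j) (cong suc i+sj≡L) ⟩
    f (r + suc j)                   ≡⟨ f-at j ⟩
    g (r + suc j) Q.+ g (r + j)     ≡⟨ cong (Q._+ g (r + j)) (sym (mirror i (suc j) i+sj≡L)) ⟩
    g (r + i) Q.+ g (r + j)         ≡⟨ QP.+-comm (g (r + i)) (g (r + j)) ⟩
    g (r + j) Q.+ g (r + i)         ∎)
    where
    open ≡-Reasoning
    i+sj≡L : i + suc j ≡ L
    i+sj≡L = trans (+-suc i j) i+j≡L

support-shift : Support g r N → Support (shift g) (suc r) (suc N)
support-shift {g} sup = record
  { r≤N    = s≤s r≤N
  ; low≢0  = low≢0
  ; high≢0 = high≢0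
  ; below  = λ { zero _ → refl ; (suc i) (s≤s i<r) → below i i<r }
  ; above  = λ { (suc i) (s≤s N<i) → above i N<i }
  }
  where open Support sup

record GammaPositive (f : Poly) (r L : ℕ) : Set where
  field
    support   : Support f r (r + L)
    symmetric : CoeffSymmetric f r L
    γ         : ℕ → ℚ
    γ-nonneg  : ∀ i → i ≤ L / 2 → 0ℚ Q.≤ γ i
    expansion : f ≈ₚ gammaSum γ r L

fromGammaPositiveRN : GammaPositiveRN f r (r + L) → GammaPositive f r L
fromGammaPositiveRN {f} {r} {L} (sup , pal , γ , γ-nonneg , expansion)
  rewrite m+n∸m≡n r L = record
  { support   = sup
  ; symmetric = palindromic⇒coeffSymmetric {f} {r} {L} pal′
  ; γ         = γ
  ; γ-nonneg  = γ-nonneg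
  ; expansion = expansion
  }
  where
  pal′ : Palindromic f r (r + L)
  pal′ i i≤ = pal i (subst (i ≤_) (cong (_/ 2) (m+n∸m≡n r L)) i≤)

toGammaPositiveRN : GammaPositive f r L → GammaPositiveRN f r (r + L)
toGammaPositiveRN {f} {r} {L} gp rewrite m+n∸m≡n r L =
  support , pal , γ , γ-nonneg , expansion
  where
  open GammaPositive gp
  pal : ∀ i → i ≤ L / 2 → f (r + i) ≡ f (r + L ∸ i)
  pal i i≤ = coeffSymmetric⇒palindromic {f} {r} {L} symmetric i
    (subst (i ≤_) (cong (_/ 2) (sym (m+n∸m≡n r L))) i≤)

gammaPositive-shift : GammaPositive g r L → GammaPositive (shift g) (suc r) L
gammaPositive-shift {g} {r} {L} gp = record
  { support   = support-shift support
  ; symmetric = symmetric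
  ; γ         = γ
  ; γ-nonneg  = γ-nonneg
  ; expansion = λ j → trans (shift-cong expansion j) (sym (gammaSum-shift γ r L j))
  }
  where open GammaPositive gp

gammaPositive-odd-factor : ∀ d (gp : GammaPositive f r (suc (d * 2))) →
  let p = gammaSum (GammaPositive.γ gp) r (d * 2) in
  (f ≈ₚ mulOnePlusT p) × GammaPositive p r (d * 2)
gammaPositive-odd-factor {f} {r} d gp = f≈ , record
  { support   = sup-p
  ; symmetric = coeffSymmetric-mulOnePlusT⁻¹ f≈ sup-p symmetric
  ; γ         = γ
  ; γ-nonneg  = λ i i≤ → γ-nonneg i (subst (i ≤_) (trans ([n*2]/2≡n d) (sym ([1+n*2]/2≡n d))) i≤)
  ; expansion = λ _ → refl
  }
  where
  open GammaPositive gp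
  p : Poly
  p = gammaSum γ r (d * 2)
  f≈ : f ≈ₚ mulOnePlusT p
  f≈ j = trans (expansion j) (gammaSum-odd γ r d j)
  sup-p : Support p r (r + d * 2)
  sup-p = support-mulOnePlusT⁻¹ f≈ (subst (Support f r) (+-suc r (d * 2)) support)
            (gammaSum-below γ r (d * 2)) (gammaSum-above γ r (d * 2))

lemma7 : (n ℓ : ℕ) (f : Poly) → GammaPositiveWith f n ℓ → ℓ % 2 ≡ 1 →
    Σ Poly λ p₁ → Σ Poly λ p₂ → Σ ℕ λ ℓ₁ → Σ ℕ λ ℓ₂ →
      (f ≈ₚ (p₁ ⊕ p₂)) ×
      GammaPositiveWith p₁ (n ∸ 1) ℓ₁ × GammaPositiveWith p₂ (suc n) ℓ₂ ×
      ℓ₁ % 2 ≡ 0 × ℓ₂ % 2 ≡ 0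
lemma7 n ℓ f (r , N , gp-RN , N+r≡n , N∸r≡ℓ) ℓ-odd =
  p , shift p , d * 2 , d * 2 , f≈ ,
  (r , r + d * 2 , toGammaPositiveRN gp-p , cong (_∸ 1) n≡ , m+n∸m≡n r (d * 2)) ,
  (suc r , suc r + d * 2 , toGammaPositiveRN (gammaPositive-shift gp-p) ,
   cong suc (trans (+-suc (r + d * 2) r) n≡) , m+n∸m≡n (suc r) (d * 2)) ,
  m*n%n≡0 d 2 , m*n%n≡0 d 2
  where
  d : ℕ
  d = ℓ / 2
  N≡ : N ≡ r + suc (d * 2)
  N≡ = begin
    N                 ≡⟨ sym (m+[n∸m]≡n (Support.r≤N (proj₁ gp-RN))) ⟩
    r + (N ∸ r)       ≡⟨ cong (r +_) N∸r≡ℓ ⟩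
    r + ℓ             ≡⟨ cong (r +_) (m≡m%n+[m/n]*n ℓ 2) ⟩
    r + (ℓ % 2 + d * 2) ≡⟨ cong (λ m → r + (m + d * 2)) ℓ-odd ⟩
    r + suc (d * 2)   ∎
    where open ≡-Reasoning
  gp : GammaPositive f r (suc (d * 2))
  gp = fromGammaPositiveRN (subst (GammaPositiveRN f r) N≡ gp-RN)
  p : Poly
  p = gammaSum (GammaPositive.γ gp) r (d * 2)
  f≈ : f ≈ₚ (p ⊕ shift p)
  f≈ = proj₁ (gammaPositive-odd-factor d gp)
  gp-p : GammaPositive p r (d * 2)
  gp-p = proj₂ (gammaPositive-odd-factor d gp)
  n≡ : suc (r + d * 2 + r) ≡ n
  n≡ = trans (cong (_+ r) (sym (trans N≡ (+-suc r (d * 2))))) N+r≡n
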